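{- Let $m\ge 1$ and let $\mathcal{J}$ be a simple input set of jobs for $m$ machines. Then for every arrival order (and every tie-breaking rule), the Greedy-strategy produces a schedule whose minimum load is at least $\frac{\mathrm{OPT}(\mathcal{J})}{100\sqrt[4]{m}}$.
   Context: Jobs with non-negative sizes arrive one by one and are assigned irrevocably to one of $m$ identical parallel machines; the load of a machine is the total size of its jobs. $\mathrm{OPT}(\mathcal{J})$ is the maximum, over all assignments of $\mathcal{J}$ to the $m$ machines, of the minimum machine load. The Greedy-strategy assigns each incoming job to a machine of currently minimum load, breaking ties arbitrarily. A job of $\mathcal{J}$ is called large if its size exceeds $\frac{\mathrm{OPT}(\mathcal{J})}{100\sqrt[4]{m}}$, and small otherwise; $k$ denotes the number of large jobs. An input set $\mathcal{J}$ of size $n$ is called simple if $n<m$, or $k\ge m$, or $k\le m-\frac{\sqrt[4]{m^3}}{50}$.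
   Formalization: The job sizes are non-negative rational numbers. -}

module Defs where

open import Data.Nat as ℕ using (ℕ; zero; suc; _∸_; _<ᵇ_)
open import Data.Fin as Fin using (Fin; toℕ)
open import Data.List using (List; foldr; map; allFin; filter; length)
open import Data.Bool using (Bool; true; false; if_then_else_; _∧_)
open import Data.Integer using (+_)
open import Data.Rational using (ℚ; 0ℚ; _+_; _*_; _≤_; _<_; _/_)
open import Data.Product using (Σ; ∃; _×_)
open import Data.Sum using (_⊎_)
open import Relation.Nullary using (Dec; yes; no; ⌊_⌋)
open import Relation.Binary.PropositionalEquality using (_≡_)

ℕ→ℚ : ℕ → ℚ
ℕ→ℚ n = + n / 1

pow4 : ℚ → ℚ
pow4 x = x * x * x * x

sumℚ : List ℚ → ℚ
sumℚ = foldr _+_ 0ℚ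

-- An input of n jobs in arrival order: job j (j-th to arrive) has size p j.
-- An assignment σ sends job j to machine σ j.
-- Load of machine i counting only the first t jobs (those with index < t).
loadPrefix : ∀ {n m} → (Fin n → ℚ) → (Fin n → Fin m) → ℕ → Fin m → ℚ
loadPrefix {n} p σ t i =
  sumℚ (map (λ j → if (toℕ j <ᵇ t) ∧ ⌊ σ j Fin.≟ i ⌋ then p j else 0ℚ) (allFin n))

load : ∀ {n m} → (Fin n → ℚ) → (Fin n → Fin m) → Fin m → ℚ
load {n} p σ i = loadPrefix p σ n i

NonNeg : ∀ {n} → (Fin n → ℚ) → Set
NonNeg p = ∀ j → 0ℚ ≤ p j

IsMinLoad : ∀ {n m} → (Fin n → ℚ) → (Fin n → Fin m) → ℚ → Set
IsMinLoad p σ o = (∀ i → o ≤ load p σ i) × (∃ λ i → load p σ i ≡ o)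

-- o = OPT(J): the maximum over all assignments of the minimum machine load
IsOPT : ∀ n m → (Fin n → ℚ) → ℚ → Set
IsOPT n m p o =
  (∃ λ (σ : Fin n → Fin m) → IsMinLoad p σ o)
  × (∀ (σ : Fin n → Fin m) → ∃ λ i → load p σ i ≤ o)

-- σ is a schedule produced by Greedy (with some tie-breaking): every job j
-- goes to a machine of minimum load among the loads before j arrives.
IsGreedy : ∀ {n m} → (Fin n → ℚ) → (Fin n → Fin m) → Set
IsGreedy p σ = ∀ j i → loadPrefix p σ (toℕ j) (σ j) ≤ loadPrefix p σ (toℕ j) i

-- For x, o ≥ 0:  x > o / (100 * m^(1/4))  ⟺  (100 x)^4 * m > o^4
ExceedsThreshold : ℕ → ℚ → ℚ → Set
ExceedsThreshold m o x = pow4 o < pow4 (ℕ→ℚ 100 * x) * ℕ→ℚ m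

-- For x, o ≥ 0:  x ≥ o / (100 * m^(1/4))  ⟺  (100 x)^4 * m ≥ o^4
AtLeastThreshold : ℕ → ℚ → ℚ → Set
AtLeastThreshold m o x = pow4 o ≤ pow4 (ℕ→ℚ 100 * x) * ℕ→ℚ m


open import Data.Rational.Properties using (_<?_)

-- k: number of large jobs (size > OPT / (100 m^(1/4)))
numLarge : ∀ {n} → ℕ → ℚ → (Fin n → ℚ) → ℕ
numLarge {n} m o p = length (filter (λ j → pow4 o <? pow4 (ℕ→ℚ 100 * p j) * ℕ→ℚ m) (allFin n))

-- simple input: n < m, or k ≥ m, or k ≤ m - m^(3/4)/50
-- (the last one, for naturals, is: k ≤ m and m^3 ≤ (50 (m - k))^4)
Simple : ∀ n m → (Fin n → ℚ) → ℚ → Set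
Simple n m p o =
  let k = numLarge m o p in
  (n ℕ.< m) ⊎ (m ℕ.≤ k) ⊎ ((k ℕ.≤ m) × (m ℕ.^ 3 ℕ.≤ (50 ℕ.* (m ∸ k)) ℕ.^ 4))

-- Suppose machine i ends with load L below the threshold, i.e. (100 L)⁴ m < OPT⁴.  Greedy puts
-- every job on a machine whose load is at that moment at most the load of i, hence at most L.
-- In an optimal schedule every machine holds a job of a set B or has load at least OPT made of
-- jobs outside B, so m OPT ≤ vol(outside B) + |B| OPT.  With B all jobs this gives OPT = 0 when
-- n < m.  A large job exceeds L, so it is never followed by another job on its machine and never
-- lies on i; hence k ≤ m - 1.  Otherwise the small load of each machine is at most L + b, where
-- b is the largest small job, and B the large jobs gives (m - k) OPT ≤ m (L + b).  Raising to
-- the fourth power and using ((L + b) / 2)⁴ ≤ (L⁴ + b⁴) / 2 and m³ ≤ (50 (m - k))⁴ contradicts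
-- (100 L)⁴ m < OPT⁴ and (100 b)⁴ m ≤ OPT⁴.
module Submission where

open import Defs
open import Algebra.Bundles using (Ring)
open import Data.Bool using (Bool; true; false; if_then_else_; _∧_; not; T)
open import Data.Bool.Properties using (T-∧)
open import Data.Empty using (⊥; ⊥-elim)
open import Data.Fin as Fin using (Fin; toℕ; punchIn)
import Data.Fin.Properties as Fin
import Data.Integer as ℤ
import Data.Integer.Properties as ℤ
open import Data.List using ([]; _∷_; map; allFin; filter; length; tabulate)
import Data.List.Relation.Unary.All.Properties as All
open import Data.Nat as ℕ using (ℕ; zero; suc; _<ᵇ_)
import Data.Nat.Properties as ℕ
open import Data.Nat.Coprimality as Coprime using ()
open import Data.Product using (∃; _×_; _,_)
open import Data.Rational as ℚ using (ℚ; mkℚ; 0ℚ; 1ℚ; _+_; _*_; _-_; -_; _≤_; _<_)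
import Data.Rational.Properties as ℚ
open import Data.Sum as Sum using (_⊎_; inj₁; inj₂; [_,_]′)
open import Function using (id; _∘_; Equivalence)
open import Level using (0ℓ)
open import Relation.Binary using (tri<; tri≈; tri>)
open import Relation.Binary.Bundles using (DecTotalOrder)
open import Relation.Binary.PropositionalEquality
open import Relation.Nullary using (Dec; yes; no; ¬_; ⌊_⌋)
open import Relation.Nullary.Decidable using (decidable-stable; dec⇒maybe; T?; toWitness; fromWitness)
open import Relation.Unary using (Decidable)
open import Tactic.RingSolver using (solve-∀)
open import Tactic.RingSolver.Core.AlmostCommutativeRing using (AlmostCommutativeRing; fromCommutativeRing)
open import Algebra.Properties.Semiring.Sum (Ring.semiring ℚ.+-*-ring)
  using (sum; sum-cong-≗; sum-replicate; sum-replicate-zero; sum-remove; ∑-comm; ∑-distrib-+; *-distribˡ-sum)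
open import Algebra.Properties.Semiring.Mult (Ring.semiring ℚ.+-*-ring)
  using (×-homo-+; ×1-homo-*; ×-assoc-*) renaming (_×_ to _·_)
open import Data.List.Extrema (DecTotalOrder.totalOrder ℚ.≤-decTotalOrder)
  using (max; ⊥≤max; xs≤max; argmax-all)
open ℚ.≤-Reasoning

-- The ring solver does not unfold pow4, so identities involving it are stated with the
-- products written out.
ℚ-ring : AlmostCommutativeRing 0ℓ 0ℓ
ℚ-ring = fromCommutativeRing ℚ.+-*-commutativeRing (λ x → dec⇒maybe (0ℚ ℚ.≟ x))

x≤x+y : ∀ x {y} → 0ℚ ≤ y → x ≤ x + y
x≤x+y x {y} 0≤y = subst (_≤ x + y) (ℚ.+-identityʳ x) (ℚ.+-monoʳ-≤ x 0≤y)

x+y≤z⇒y≤z-x : ∀ {x y z} → x + y ≤ z → y ≤ z - x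
x+y≤z⇒y≤z-x {x} {y} {z} le = subst (_≤ z - x) (cancel x y) (ℚ.+-monoˡ-≤ (- x) le)
  where
  cancel : ∀ a b → a + b - a ≡ b
  cancel = solve-∀ ℚ-ring

+-cancelʳ-≤ : ∀ x y z → x + z ≤ y + z → x ≤ y
+-cancelʳ-≤ x y z le = subst₂ _≤_ (cancel x z) (cancel y z) (ℚ.+-monoˡ-≤ (- z) le)
  where
  cancel : ∀ a b → a + b - b ≡ a
  cancel = solve-∀ ℚ-ring

*-nonNeg : ∀ {x y} → 0ℚ ≤ x → 0ℚ ≤ y → 0ℚ ≤ x * y
*-nonNeg {x} {y} 0≤x 0≤y =
  ℚ.nonNegative⁻¹ _ {{ℚ.nonNeg*nonNeg⇒nonNeg x {{ℚ.nonNegative 0≤x}} y {{ℚ.nonNegative 0≤y}}}}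

*-pos : ∀ {x y} → 0ℚ < x → 0ℚ < y → 0ℚ < x * y
*-pos {x} {y} 0<x 0<y = ℚ.positive⁻¹ _ {{ℚ.pos*pos⇒pos x {{ℚ.positive 0<x}} y {{ℚ.positive 0<y}}}}

*-mono-≤-nonNeg : ∀ {a b c d} → 0ℚ ≤ a → 0ℚ ≤ c → a ≤ b → c ≤ d → a * c ≤ b * d
*-mono-≤-nonNeg {a} {b} {c} {d} 0≤a 0≤c a≤b c≤d = ℚ.≤-trans
  (ℚ.*-monoʳ-≤-nonNeg c {{ℚ.nonNegative 0≤c}} a≤b)
  (ℚ.*-monoˡ-≤-nonNeg b {{ℚ.nonNegative (ℚ.≤-trans 0≤a a≤b)}} c≤d)

square-nonNeg : ∀ x → 0ℚ ≤ x * x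
square-nonNeg x with ℚ.≤-total 0ℚ x
... | inj₁ 0≤x = *-nonNeg 0≤x 0≤x
... | inj₂ x≤0 = subst (0ℚ ≤_) (neg*neg x) (*-nonNeg (ℚ.neg-antimono-≤ x≤0) (ℚ.neg-antimono-≤ x≤0))
  where
  neg*neg : ∀ x → - x * - x ≡ x * x
  neg*neg = solve-∀ ℚ-ring

-- Natural numbers as rationals

ℕ→ℚ-suc : ∀ n → ℕ→ℚ (suc n) ≡ 1ℚ + ℕ→ℚ n
ℕ→ℚ-suc n = trans (ℚ./-cong (cong (λ z → ℤ.+ 1 ℤ.+ z) (sym (ℤ.*-identityʳ (ℤ.+ n)))) refl)
                  (cong (1ℚ +_) (sym (ℚ.↥p/↧p≡p (mkℚ (ℤ.+ n) 0 (Coprime.sym (Coprime.1-coprimeTo n))))))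

-- Seeing ℕ→ℚ n as the monoid multiple n · 1 makes the library's homomorphism laws available.
ℕ→ℚ≡·1 : ∀ n → ℕ→ℚ n ≡ n · 1ℚ
ℕ→ℚ≡·1 zero    = refl
ℕ→ℚ≡·1 (suc n) = trans (ℕ→ℚ-suc n) (cong (1ℚ +_) (ℕ→ℚ≡·1 n))

ℕ→ℚ-+ : ∀ a b → ℕ→ℚ (a ℕ.+ b) ≡ ℕ→ℚ a + ℕ→ℚ b
ℕ→ℚ-+ a b = trans (ℕ→ℚ≡·1 (a ℕ.+ b))
  (trans (×-homo-+ 1ℚ a b) (sym (cong₂ _+_ (ℕ→ℚ≡·1 a) (ℕ→ℚ≡·1 b))))

ℕ→ℚ-* : ∀ a b → ℕ→ℚ (a ℕ.* b) ≡ ℕ→ℚ a * ℕ→ℚ b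
ℕ→ℚ-* a b = trans (ℕ→ℚ≡·1 (a ℕ.* b))
  (trans (×1-homo-* a b) (sym (cong₂ _*_ (ℕ→ℚ≡·1 a) (ℕ→ℚ≡·1 b))))

ℕ→ℚ-cube : ∀ a → ℕ→ℚ (a ℕ.^ 3) ≡ ℕ→ℚ a * ℕ→ℚ a * ℕ→ℚ a
ℕ→ℚ-cube a = begin-equality
  ℕ→ℚ (a ℕ.* (a ℕ.* (a ℕ.* 1)))   ≡⟨ ℕ→ℚ-* a _ ⟩
  x * ℕ→ℚ (a ℕ.* (a ℕ.* 1))       ≡⟨ cong (x *_) (ℕ→ℚ-* a _) ⟩
  x * (x * ℕ→ℚ (a ℕ.* 1))         ≡⟨ cong (λ y → x * (x * ℕ→ℚ y)) (ℕ.*-identityʳ a) ⟩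
  x * (x * x)                     ≡⟨ ℚ.*-assoc x x x ⟨
  x * x * x                       ∎
  where
  x = ℕ→ℚ a

ℕ→ℚ-pow4 : ∀ a → ℕ→ℚ (a ℕ.^ 4) ≡ pow4 (ℕ→ℚ a)
ℕ→ℚ-pow4 a = trans (ℕ→ℚ-* a (a ℕ.^ 3)) (trans (cong (ℕ→ℚ a *_) (ℕ→ℚ-cube a)) (reassoc (ℕ→ℚ a)))
  where
  reassoc : ∀ x → x * (x * x * x) ≡ x * x * x * x
  reassoc = solve-∀ ℚ-ring

ℕ→ℚ-nonNeg : ∀ n → 0ℚ ≤ ℕ→ℚ n
ℕ→ℚ-nonNeg n = ℚ.nonNegative⁻¹ _ {{ℚ.normalize-nonNeg n 1}}

ℕ→ℚ-mono-≤ : ∀ {a b} → a ℕ.≤ b → ℕ→ℚ a ≤ ℕ→ℚ b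
ℕ→ℚ-mono-≤ {a} {b} a≤b = subst (λ k → ℕ→ℚ a ≤ ℕ→ℚ k) (ℕ.m+[n∸m]≡n a≤b)
  (subst (ℕ→ℚ a ≤_) (sym (ℕ→ℚ-+ a (b ℕ.∸ a))) (x≤x+y (ℕ→ℚ a) (ℕ→ℚ-nonNeg (b ℕ.∸ a))))

ℕ→ℚ-mono-< : ∀ {a b} → a ℕ.< b → ℕ→ℚ a < ℕ→ℚ b
ℕ→ℚ-mono-< {a} a<b = ℚ.<-≤-trans
  (subst (_< 1ℚ + ℕ→ℚ a) (ℚ.+-identityˡ (ℕ→ℚ a)) (ℚ.+-monoˡ-< (ℕ→ℚ a) (ℚ.positive⁻¹ 1ℚ)))
  (subst (_≤ _) (ℕ→ℚ-suc a) (ℕ→ℚ-mono-≤ a<b))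

-- Fourth powers

pow4-nonNeg : ∀ x → 0ℚ ≤ pow4 x
pow4-nonNeg x = subst (0ℚ ≤_) (regroup x) (*-nonNeg (square-nonNeg x) (square-nonNeg x))
  where
  regroup : ∀ x → (x * x) * (x * x) ≡ x * x * x * x
  regroup = solve-∀ ℚ-ring

pow4-mono-≤ : ∀ {x y} → 0ℚ ≤ x → x ≤ y → pow4 x ≤ pow4 y
pow4-mono-≤ {x} {y} 0≤x x≤y = step 0≤x³ (step 0≤x² (step 0≤x x≤y))
  where
  step : ∀ {a b} → 0ℚ ≤ a → a ≤ b → a * x ≤ b * y
  step 0≤a a≤b = *-mono-≤-nonNeg 0≤a 0≤x a≤b x≤y
  0≤x² = *-nonNeg 0≤x 0≤x
  0≤x³ = *-nonNeg 0≤x² 0≤x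

pow4-* : ∀ x y → pow4 (x * y) ≡ pow4 x * pow4 y
pow4-* = expand
  where
  expand : ∀ x y → (x * y) * (x * y) * (x * y) * (x * y) ≡ (x * x * x * x) * (y * y * y * y)
  expand = solve-∀ ℚ-ring

pow4-midpoint-convex : ∀ u v → pow4 (u + v) + pow4 (u + v) ≤ pow4 (u + u) + pow4 (v + v)
pow4-midpoint-convex u v = subst (pow4 (u + v) + pow4 (u + v) ≤_) (sym (expand u v))
  (x≤x+y _ (*-nonNeg (square-nonNeg (u - v))
    (ℚ.+-mono-≤ (*-nonNeg (ℕ→ℚ-nonNeg 12) (square-nonNeg (u + v)))
                (*-nonNeg (ℕ→ℚ-nonNeg 2) (square-nonNeg (u - v))))))
  where
  expand : ∀ u v →
    (u + u) * (u + u) * (u + u) * (u + u) + (v + v) * (v + v) * (v + v) * (v + v) ≡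
    ((u + v) * (u + v) * (u + v) * (u + v) + (u + v) * (u + v) * (u + v) * (u + v)) +
    ((u - v) * (u - v)) * (ℕ→ℚ 12 * ((u + v) * (u + v)) + ℕ→ℚ 2 * ((u - v) * (u - v)))
  expand = solve-∀ ℚ-ring

volume-threshold-contradiction : ∀ {M o c D L b} → 0ℚ < M → 0ℚ ≤ o → 0ℚ ≤ c → 0ℚ ≤ D →
  pow4 ((c + c) * L) * M < pow4 o → pow4 ((c + c) * b) * M ≤ pow4 o →
  D * o ≤ M * (L + b) → M * M * M ≤ pow4 (c * D) → ⊥
volume-threshold-contradiction {M} {o} {c} {D} {L} {b} 0<M 0≤o 0≤c 0≤D L-below b-within volume cube≤ =
  begin-contradiction
  X + X                                                   ≡⟨ cong₂ _+_ regroup regroup ⟩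
  pow4 (c * (D * o)) + pow4 (c * (D * o))                 ≤⟨ ℚ.+-mono-≤ grow grow ⟩
  pow4 (c * (M * (L + b))) + pow4 (c * (M * (L + b)))     ≡⟨ cong₂ _+_ factor factor ⟩
  M⁴ * Y + M⁴ * Y                                         ≡⟨ ℚ.*-distribˡ-+ M⁴ Y Y ⟨
  M⁴ * (Y + Y)
    ≤⟨ ℚ.*-monoˡ-≤-nonNeg M⁴ {{ℚ.nonNegative (pow4-nonNeg M)}} (pow4-midpoint-convex (c * L) (c * b)) ⟩
  M⁴ * (pow4 (c * L + c * L) + pow4 (c * b + c * b))      ≡⟨ spread M c L b ⟩
  M³ * (pow4 ((c + c) * L) * M + pow4 ((c + c) * b) * M)
    <⟨ ℚ.*-monoʳ-<-pos M³ {{ℚ.positive 0<M³}} (ℚ.+-mono-<-≤ L-below b-within) ⟩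
  M³ * (pow4 o + pow4 o)                                  ≡⟨ ℚ.*-distribˡ-+ M³ (pow4 o) (pow4 o) ⟩
  M³ * pow4 o + M³ * pow4 o                               ≤⟨ ℚ.+-mono-≤ cube-bound cube-bound ⟩
  X + X                                                   ∎
  where
  X = pow4 (c * D) * pow4 o
  Y = pow4 (c * L + c * b)
  M³ = M * M * M
  M⁴ = pow4 M
  0<M³ : 0ℚ < M³
  0<M³ = *-pos (*-pos 0<M 0<M) 0<M
  regroup : X ≡ pow4 (c * (D * o))
  regroup = trans (sym (pow4-* (c * D) o)) (cong pow4 (ℚ.*-assoc c D o))
  grow : pow4 (c * (D * o)) ≤ pow4 (c * (M * (L + b)))
  grow = pow4-mono-≤ (*-nonNeg 0≤c (*-nonNeg 0≤D 0≤o)) (ℚ.*-monoˡ-≤-nonNeg c {{ℚ.nonNegative 0≤c}} volume)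
  factor : pow4 (c * (M * (L + b))) ≡ M⁴ * Y
  factor = trans (cong pow4 (distribute c M L b)) (pow4-* M (c * L + c * b))
    where
    distribute : ∀ c M L b → c * (M * (L + b)) ≡ M * (c * L + c * b)
    distribute = solve-∀ ℚ-ring
  spread : ∀ M c L b →
    M * M * M * M * ((c * L + c * L) * (c * L + c * L) * (c * L + c * L) * (c * L + c * L) +
                     (c * b + c * b) * (c * b + c * b) * (c * b + c * b) * (c * b + c * b)) ≡
    M * M * M * ((c + c) * L * ((c + c) * L) * ((c + c) * L) * ((c + c) * L) * M +
                 (c + c) * b * ((c + c) * b) * ((c + c) * b) * ((c + c) * b) * M)
  spread = solve-∀ ℚ-ring
  cube-bound : M³ * pow4 o ≤ X
  cube-bound = ℚ.*-monoʳ-≤-nonNeg (pow4 o) {{ℚ.nonNegative (pow4-nonNeg o)}} cube≤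

-- Finite sums

sumℚ-map-tabulate : ∀ {A : Set} {n} (g : Fin n → A) (f : A → ℚ) →
                    sumℚ (map f (tabulate g)) ≡ sum (f ∘ g)
sumℚ-map-tabulate {n = zero}  g f = refl
sumℚ-map-tabulate {n = suc n} g f = cong (f (g Fin.zero) +_) (sumℚ-map-tabulate (g ∘ Fin.suc) f)

sum-mono-≤ : ∀ {n} {f g : Fin n → ℚ} → (∀ t → f t ≤ g t) → sum f ≤ sum g
sum-mono-≤ {zero}  f≤g = ℚ.≤-refl
sum-mono-≤ {suc n} f≤g = ℚ.+-mono-≤ (f≤g Fin.zero) (sum-mono-≤ (f≤g ∘ Fin.suc))

sum-zero : ∀ {n} {f : Fin n → ℚ} → (∀ t → f t ≡ 0ℚ) → sum f ≡ 0ℚ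
sum-zero {n} f≡0 = trans (sum-cong-≗ f≡0) (sum-replicate-zero n)

sum-nonNeg : ∀ {n} {f : Fin n → ℚ} → (∀ t → 0ℚ ≤ f t) → 0ℚ ≤ sum f
sum-nonNeg {n} {f} 0≤f = subst (_≤ sum f) (sum-replicate-zero n) (sum-mono-≤ {g = f} 0≤f)

term≤sum : ∀ {n} {f : Fin n → ℚ} → (∀ t → 0ℚ ≤ f t) → ∀ u → f u ≤ sum f
term≤sum {suc n} {f} 0≤f u = subst (f u ≤_) (sym (sum-remove f))
  (x≤x+y (f u) (sum-nonNeg (0≤f ∘ punchIn u)))

sum-single : ∀ {n} (f : Fin n → ℚ) u → (∀ t → t ≢ u → f t ≡ 0ℚ) → sum f ≡ f u
sum-single {suc n} f u f≡0 = begin-equality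
  sum f                          ≡⟨ sum-remove f ⟩
  f u + sum (f ∘ punchIn u)      ≡⟨ cong (f u +_) (sum-zero (λ t → f≡0 _ (Fin.punchInᵢ≢i u t))) ⟩
  f u + 0ℚ                       ≡⟨ ℚ.+-identityʳ (f u) ⟩
  f u                            ∎

sum-const : ∀ n x → sum {n} (λ _ → x) ≡ ℕ→ℚ n * x
sum-const n x = begin-equality
  sum {n} (λ _ → x)   ≡⟨ sum-replicate n ⟩
  n · x               ≡⟨ cong (n ·_) (ℚ.*-identityˡ x) ⟨
  n · (1ℚ * x)        ≡⟨ ×-assoc-* n 1ℚ x ⟨
  (n · 1ℚ) * x        ≡⟨ cong (_* x) (ℕ→ℚ≡·1 n) ⟨
  ℕ→ℚ n * x           ∎

ℕ→ℚ-length-filter : ∀ {A : Set} {P : A → Set} (P? : Decidable P) xs →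
                    ℕ→ℚ (length (filter P? xs)) ≡ sumℚ (map (λ x → if ⌊ P? x ⌋ then 1ℚ else 0ℚ) xs)
ℕ→ℚ-length-filter P? []       = refl
ℕ→ℚ-length-filter P? (x ∷ xs) with P? x
... | yes _ = trans (ℕ→ℚ-suc (length (filter P? xs))) (cong (1ℚ +_) (ℕ→ℚ-length-filter P? xs))
... | no  _ = trans (ℕ→ℚ-length-filter P? xs)
                    (sym (ℚ.+-identityˡ (sumℚ (map (λ x → if ⌊ P? x ⌋ then 1ℚ else 0ℚ) xs))))

restrict : ∀ {n} → (Fin n → Bool) → (Fin n → ℚ) → Fin n → ℚ
restrict B f t = if B t then f t else 0ℚ

module _ {n} (B : Fin n → Bool) where

  restrict-T : ∀ {f t} → T (B t) → restrict B f t ≡ f t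
  restrict-T {t = t} Bt with B t
  ... | true = refl

  restrict-¬T : ∀ {f t} → ¬ T (B t) → restrict B f t ≡ 0ℚ
  restrict-¬T {t = t} ¬Bt with B t
  ... | true  = ⊥-elim (¬Bt _)
  ... | false = refl

  restrict-mono-≤ : ∀ {f g} → (∀ t → f t ≤ g t) → ∀ t → restrict B f t ≤ restrict B g t
  restrict-mono-≤ f≤g t with B t
  ... | true  = f≤g t
  ... | false = ℚ.≤-refl

  restrict-nonNeg : ∀ {f} → (∀ t → 0ℚ ≤ f t) → ∀ t → 0ℚ ≤ restrict B f t
  restrict-nonNeg 0≤f t with B t
  ... | true  = 0≤f t
  ... | false = ℚ.≤-refl

  restrict-≤ : ∀ {f} → (∀ t → 0ℚ ≤ f t) → ∀ t → restrict B f t ≤ f t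
  restrict-≤ 0≤f t with B t
  ... | true  = ℚ.≤-refl
  ... | false = 0≤f t

restrict-∧ : ∀ {n} (B C : Fin n → Bool) f t → restrict (λ u → B u ∧ C u) f t ≡ restrict B (restrict C f) t
restrict-∧ B C f t with B t
... | true  = refl
... | false = refl

restrict-∧-not : ∀ {n} (B C : Fin n → Bool) f t → ¬ T (B t ∧ C t) →
                 restrict B (restrict (not ∘ C) f) t ≡ restrict B f t
restrict-∧-not B C f t ¬Bt∧Ct with B t | C t
... | true  | true  = ⊥-elim (¬Bt∧Ct _)
... | true  | false = refl
... | false | _     = refl

sum-indicator≤1 : ∀ {n} (B : Fin n → Bool) → (∀ t u → T (B t) → T (B u) → t ≡ u) →
                  sum (restrict B (λ _ → 1ℚ)) ≤ 1ℚ
sum-indicator≤1 B unique with Fin.any? (T? ∘ B)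
... | yes (u , Bu) = ℚ.≤-reflexive
  (trans (sum-single _ u (λ t t≢u → restrict-¬T B (λ Bt → t≢u (unique t u Bt Bu)))) (restrict-T B Bu))
... | no ∄ =
  subst (_≤ 1ℚ) (sym (sum-zero (λ t → restrict-¬T B (λ Bt → ∄ (t , Bt))))) (ℚ.nonNegative⁻¹ 1ℚ)

before : ∀ {n} → ℕ → Fin n → Bool
before s t = toℕ t <ᵇ s

prefixSum : ∀ {n} → ℕ → (Fin n → ℚ) → ℚ
prefixSum s = sum ∘ restrict (before s)

-- Induction from the front: dropping the first term f₀ lowers every prefix bound by f₀.
sum≤prefixBound+term : ∀ {n} (f : Fin n → ℚ) L → (∀ t → f t ≡ 0ℚ ⊎ prefixSum (toℕ t) f ≤ L) →
                       sum f ≡ 0ℚ ⊎ ∃ λ t → sum f ≤ L + f t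
sum≤prefixBound+term {zero}  f L bounded = inj₁ refl
sum≤prefixBound+term {suc n} f L bounded
  with sum≤prefixBound+term (f ∘ Fin.suc) (L - f Fin.zero) (Sum.map₂ x+y≤z⇒y≤z-x ∘ bounded ∘ Fin.suc)
... | inj₂ (t , rest≤) =
  inj₂ (Fin.suc t , subst (sum f ≤_) (cancel (f Fin.zero) L _) (ℚ.+-monoʳ-≤ (f Fin.zero) rest≤))
  where
  cancel : ∀ a b c → a + (b - a + c) ≡ b + c
  cancel = solve-∀ ℚ-ring
... | inj₁ rest≡0 with bounded Fin.zero
...   | inj₁ f₀≡0          = inj₁ (cong₂ _+_ f₀≡0 rest≡0)
...   | inj₂ empty-prefix≤L = inj₂ (Fin.zero ,
  subst₂ _≤_ (cong (f Fin.zero +_) (sym rest≡0)) (ℚ.+-comm (f Fin.zero) L)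
             (ℚ.+-monoʳ-≤ (f Fin.zero) (subst (_≤ L) (sum-replicate-zero (suc n)) empty-prefix≤L)))

-- Schedules

onMachine : ∀ {n m} → (Fin n → Fin m) → Fin m → Fin n → Bool
onMachine σ j t = ⌊ σ t Fin.≟ j ⌋

machineSum : ∀ {n m} → (Fin n → Fin m) → Fin m → (Fin n → ℚ) → ℚ
machineSum σ j f = sum (restrict (onMachine σ j) f)

module _ {n m} (p : Fin n → ℚ) (σ : Fin n → Fin m) where

  loadPrefix≡prefixSum : ∀ s j → loadPrefix p σ s j ≡ prefixSum s (restrict (onMachine σ j) p)
  loadPrefix≡prefixSum s j =
    trans (sumℚ-map-tabulate id (restrict (λ t → before s t ∧ onMachine σ j t) p))
          (sum-cong-≗ (restrict-∧ (before s) (onMachine σ j) p))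

  load≡machineSum : ∀ j → load p σ j ≡ machineSum σ j p
  load≡machineSum j = trans (loadPrefix≡prefixSum n j)
    (sum-cong-≗ (λ t → restrict-T (before n) {restrict (onMachine σ j) p} {t} (ℕ.<⇒<ᵇ (Fin.toℕ<n t))))

sum-over-machines : ∀ {n m} (σ : Fin n → Fin m) f → sum (λ j → machineSum σ j f) ≡ sum f
sum-over-machines σ f = trans (∑-comm (λ j → restrict (onMachine σ j) f)) (sum-cong-≗ on-own-machine)
  where
  on-own-machine : ∀ t → sum (λ j → restrict (onMachine σ j) f t) ≡ f t
  on-own-machine t = trans
    (sum-single _ (σ t) (λ j j≢σt → restrict-¬T (onMachine σ j) {f} (j≢σt ∘ sym ∘ toWitness)))
    (restrict-T (onMachine σ (σ t)) {f} (fromWitness refl))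

module _ {n m} {p : Fin n → ℚ} (p≥0 : NonNeg p) (σ : Fin n → Fin m) where

  load-nonNeg : ∀ j → 0ℚ ≤ load p σ j
  load-nonNeg j = subst (0ℚ ≤_) (sym (load≡machineSum p σ j)) (sum-nonNeg (restrict-nonNeg (onMachine σ j) p≥0))

  loadPrefix≤load : ∀ s j → loadPrefix p σ s j ≤ load p σ j
  loadPrefix≤load s j = subst₂ _≤_ (sym (loadPrefix≡prefixSum p σ s j)) (sym (load≡machineSum p σ j))
    (sum-mono-≤ (restrict-≤ (before s) (restrict-nonNeg (onMachine σ j) p≥0)))

  job≤loadPrefix : ∀ {u s j} → toℕ u ℕ.< s → σ u ≡ j → p u ≤ loadPrefix p σ s j
  job≤loadPrefix {u} {s} {j} u<s σu≡j = begin
    p u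
      ≡⟨ restrict-T (onMachine σ j) {p} {u} (fromWitness σu≡j) ⟨
    restrict (onMachine σ j) p u
      ≡⟨ restrict-T (before s) {restrict (onMachine σ j) p} {u} (ℕ.<⇒<ᵇ u<s) ⟨
    restrict (before s) (restrict (onMachine σ j) p) u
      ≤⟨ term≤sum (restrict-nonNeg (before s) (restrict-nonNeg (onMachine σ j) p≥0)) u ⟩
    prefixSum s (restrict (onMachine σ j) p)          ≡⟨ loadPrefix≡prefixSum p σ s j ⟨
    loadPrefix p σ s j                                ∎

  job≤load : ∀ {u j} → σ u ≡ j → p u ≤ load p σ j
  job≤load σu≡j = job≤loadPrefix (Fin.toℕ<n _) σu≡j

  -- Machine j either holds a B-job, worth o on the right, or has load at least o made of jobs
  -- outside B.
  machine-volume-bound : ∀ {o} → 0ℚ ≤ o → (B : Fin n → Bool) → ∀ j → o ≤ load p σ j →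
    o ≤ machineSum σ j (restrict (not ∘ B) p) + o * machineSum σ j (restrict B (λ _ → 1ℚ))
  machine-volume-bound {o} 0≤o B j o≤load = by-cases (Fin.any? (λ t → T? (onMachine σ j t ∧ B t)))
    where
    S = machineSum σ j (restrict (not ∘ B) p)
    N = machineSum σ j (restrict B (λ _ → 1ℚ))
    by-cases : Dec (∃ λ t → T (onMachine σ j t ∧ B t)) → o ≤ S + o * N
    by-cases (yes (t , jt∧Bt)) = begin
      o              ≡⟨ ℚ.*-identityʳ o ⟨
      o * 1ℚ         ≤⟨ ℚ.*-monoˡ-≤-nonNeg o {{ℚ.nonNegative 0≤o}} 1≤N ⟩
      o * N          ≡⟨ ℚ.+-identityˡ (o * N) ⟨
      0ℚ + o * N
        ≤⟨ ℚ.+-monoˡ-≤ (o * N) (sum-nonNeg (restrict-nonNeg (onMachine σ j) (restrict-nonNeg (not ∘ B) p≥0))) ⟩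
      S + o * N      ∎
      where
      1≤N : 1ℚ ≤ N
      1≤N = begin
        1ℚ
          ≡⟨ restrict-T (λ u → onMachine σ j u ∧ B u) {λ _ → 1ℚ} {t} jt∧Bt ⟨
        restrict (λ u → onMachine σ j u ∧ B u) (λ _ → 1ℚ) t
          ≡⟨ restrict-∧ (onMachine σ j) B (λ _ → 1ℚ) t ⟩
        restrict (onMachine σ j) (restrict B (λ _ → 1ℚ)) t
          ≤⟨ term≤sum (restrict-nonNeg (onMachine σ j) (restrict-nonNeg B (λ _ → ℚ.nonNegative⁻¹ 1ℚ))) t ⟩
        N ∎
    by-cases (no ∄) = begin
      o                 ≤⟨ o≤load ⟩
      load p σ j        ≡⟨ load≡machineSum p σ j ⟩
      machineSum σ j p  ≡⟨ sum-cong-≗ (λ t → restrict-∧-not (onMachine σ j) B p t (∄ ∘ (t ,_))) ⟨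
      S                 ≡⟨ ℚ.+-identityʳ S ⟨
      S + 0ℚ            ≡⟨ cong (S +_) (ℚ.*-zeroʳ o) ⟨
      S + o * 0ℚ        ≡⟨ cong (λ x → S + o * x) N≡0 ⟨
      S + o * N         ∎
      where
      N≡0 : N ≡ 0ℚ
      N≡0 = sum-zero (λ t → trans (sym (restrict-∧ (onMachine σ j) B (λ _ → 1ℚ) t))
                                  (restrict-¬T (λ u → onMachine σ j u ∧ B u) {λ _ → 1ℚ} {t} (∄ ∘ (t ,_))))

  volume-bound : ∀ {o} → 0ℚ ≤ o → (∀ j → o ≤ load p σ j) → (B : Fin n → Bool) →
                 ℕ→ℚ m * o ≤ sum (restrict (not ∘ B) p) + o * sum (restrict B (λ _ → 1ℚ))
  volume-bound {o} 0≤o o≤load B = begin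
    ℕ→ℚ m * o                     ≡⟨ sum-const m o ⟨
    sum {m} (λ _ → o)             ≤⟨ sum-mono-≤ (λ j → machine-volume-bound 0≤o B j (o≤load j)) ⟩
    sum (λ j → S j + o * N j)     ≡⟨ ∑-distrib-+ S (λ j → o * N j) ⟩
    sum S + sum (λ j → o * N j)   ≡⟨ cong (sum S +_) (*-distribˡ-sum o N) ⟨
    sum S + o * sum N             ≡⟨ cong₂ (λ x y → x + o * y) (sum-over-machines σ _) (sum-over-machines σ _) ⟩
    sum (restrict (not ∘ B) p) + o * sum (restrict B (λ _ → 1ℚ)) ∎
    where
    S N : Fin m → ℚ
    S j = machineSum σ j (restrict (not ∘ B) p)
    N j = machineSum σ j (restrict B (λ _ → 1ℚ))

injective-avoiding⇒count≤ : ∀ {n m} (σ : Fin n → Fin (suc m)) (C : Fin n → Bool) i →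
  (∀ t u → T (C t) → T (C u) → σ t ≡ σ u → t ≡ u) → (∀ t → T (C t) → σ t ≢ i) →
  sum (restrict C (λ _ → 1ℚ)) ≤ ℕ→ℚ m
injective-avoiding⇒count≤ {n} {m} σ C i injective avoids-i = begin
  sum (restrict C (λ _ → 1ℚ))       ≡⟨ sum-over-machines σ (restrict C (λ _ → 1ℚ)) ⟨
  sum N                             ≡⟨ sum-remove {i = i} N ⟩
  N i + sum (N ∘ punchIn i)         ≤⟨ ℚ.+-mono-≤ (ℚ.≤-reflexive N-i≡0) (sum-mono-≤ (N≤1 ∘ punchIn i)) ⟩
  0ℚ + sum {m} (λ _ → 1ℚ)           ≡⟨ ℚ.+-identityˡ _ ⟩
  sum {m} (λ _ → 1ℚ)                ≡⟨ sum-const m 1ℚ ⟩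
  ℕ→ℚ m * 1ℚ                        ≡⟨ ℚ.*-identityʳ (ℕ→ℚ m) ⟩
  ℕ→ℚ m                             ∎
  where
  N : Fin (suc m) → ℚ
  N j = machineSum σ j (restrict C (λ _ → 1ℚ))
  N≡count : ∀ j → N j ≡ sum (restrict (λ t → onMachine σ j t ∧ C t) (λ _ → 1ℚ))
  N≡count j = sum-cong-≗ (λ t → sym (restrict-∧ (onMachine σ j) C (λ _ → 1ℚ) t))
  split : ∀ {j t} → T (onMachine σ j t ∧ C t) → σ t ≡ j × T (C t)
  split jt∧Ct = let jt , Ct = Equivalence.to T-∧ jt∧Ct in toWitness jt , Ct
  N≤1 : ∀ j → N j ≤ 1ℚ
  N≤1 j = subst (_≤ 1ℚ) (sym (N≡count j)) (sum-indicator≤1 (λ t → onMachine σ j t ∧ C t) unique)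
    where
    unique : ∀ t u → T (onMachine σ j t ∧ C t) → T (onMachine σ j u ∧ C u) → t ≡ u
    unique t u jt∧Ct ju∧Cu = let σt≡j , Ct = split jt∧Ct ; σu≡j , Cu = split ju∧Cu in
      injective t u Ct Cu (trans σt≡j (sym σu≡j))
  N-i≡0 : N i ≡ 0ℚ
  N-i≡0 = trans (N≡count i) (sum-zero (λ t → restrict-¬T (λ u → onMachine σ i u ∧ C u) {λ _ → 1ℚ} {t}
    (λ it∧Ct → let σt≡i , Ct = split it∧Ct in avoids-i t Ct σt≡i)))

module _ {n m} {p : Fin n → ℚ} (p≥0 : NonNeg p) {o} (isOpt : IsOPT n m p o) where

  opt-nonNeg : 0ℚ ≤ o
  opt-nonNeg = let (σ* , _ , j , load≡o) , _ = isOpt in subst (0ℚ ≤_) load≡o (load-nonNeg p≥0 σ* j)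

  opt-volume-bound : (B : Fin n → Bool) →
                     ℕ→ℚ m * o ≤ sum (restrict (not ∘ B) p) + o * sum (restrict B (λ _ → 1ℚ))
  opt-volume-bound = let (σ* , o≤load , _) , _ = isOpt in volume-bound p≥0 σ* opt-nonNeg o≤load

  few-jobs⇒opt≡0 : n ℕ.< m → o ≡ 0ℚ
  few-jobs⇒opt≡0 n<m = ℚ.≤-antisym (ℚ.≮⇒≥ opt-not-pos) opt-nonNeg
    where
    opt-not-pos : ¬ (0ℚ < o)
    opt-not-pos 0<o = begin-contradiction
      ℕ→ℚ n * o
        <⟨ ℚ.*-monoˡ-<-pos o {{ℚ.positive 0<o}} (ℕ→ℚ-mono-< n<m) ⟩
      ℕ→ℚ m * o
        ≤⟨ opt-volume-bound (λ _ → true) ⟩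
      sum {n} (λ _ → 0ℚ) + o * sum {n} (λ _ → 1ℚ)
        ≡⟨ cong₂ (λ x y → x + o * y) (sum-replicate-zero n) (sum-const n 1ℚ) ⟩
      0ℚ + o * (ℕ→ℚ n * 1ℚ)
        ≡⟨ simplify (ℕ→ℚ n) o ⟩
      ℕ→ℚ n * o ∎
      where
      simplify : ∀ x o → 0ℚ + o * (x * 1ℚ) ≡ x * o
      simplify = solve-∀ ℚ-ring

-- Greedy schedules

module _ {n m} {p : Fin n → ℚ} {σ : Fin n → Fin m} (p≥0 : NonNeg p) (greedy : IsGreedy p σ) where

  greedy-loadPrefix≤load : ∀ t i → loadPrefix p σ (toℕ t) (σ t) ≤ load p σ i
  greedy-loadPrefix≤load t i = ℚ.≤-trans (greedy t i) (loadPrefix≤load p≥0 σ (toℕ t) i)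

  greedy-earlier≤load : ∀ {u t} i → toℕ u ℕ.< toℕ t → σ u ≡ σ t → p u ≤ load p σ i
  greedy-earlier≤load i u<t σu≡σt =
    ℚ.≤-trans (job≤loadPrefix p≥0 σ u<t σu≡σt) (greedy-loadPrefix≤load _ i)

  greedy-aboveLoad-injective : ∀ i {t u} → load p σ i < p t → load p σ i < p u → σ t ≡ σ u → t ≡ u
  greedy-aboveLoad-injective i {t} {u} L<pt L<pu σt≡σu with Fin.<-cmp t u
  ... | tri< t<u _ _ = ⊥-elim (ℚ.<-irrefl refl (ℚ.<-≤-trans L<pt (greedy-earlier≤load i t<u σt≡σu)))
  ... | tri≈ _ t≡u _ = t≡u
  ... | tri> _ _ u<t = ⊥-elim (ℚ.<-irrefl refl (ℚ.<-≤-trans L<pu (greedy-earlier≤load i u<t (sym σt≡σu))))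

  -- When the last C-job went to j, Greedy saw j no fuller than i.
  greedy-classLoad≤ : (C : Fin n → Bool) {b : ℚ} → 0ℚ ≤ b → (∀ t → restrict C p t ≤ b) →
                      ∀ i j → machineSum σ j (restrict C p) ≤ load p σ i + b
  greedy-classLoad≤ C {b} 0≤b C≤b i j = [ via-zero , via-term ]′ (sum≤prefixBound+term f L prefix-bounded)
    where
    L = load p σ i
    f = restrict (onMachine σ j) (restrict C p)
    prefix-bounded : ∀ t → f t ≡ 0ℚ ⊎ prefixSum (toℕ t) f ≤ L
    prefix-bounded t with σ t Fin.≟ j
    ... | no _     = inj₁ refl
    ... | yes σt≡j = inj₂ (begin
      prefixSum (toℕ t) f
        ≤⟨ sum-mono-≤ (restrict-mono-≤ (before (toℕ t)) (restrict-mono-≤ (onMachine σ j) (restrict-≤ C p≥0))) ⟩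
      prefixSum (toℕ t) (restrict (onMachine σ j) p)
        ≡⟨ loadPrefix≡prefixSum p σ (toℕ t) j ⟨
      loadPrefix p σ (toℕ t) j
        ≤⟨ subst (λ k → loadPrefix p σ (toℕ t) k ≤ L) σt≡j (greedy-loadPrefix≤load t i) ⟩
      L ∎)
    via-zero : sum f ≡ 0ℚ → sum f ≤ L + b
    via-zero sum≡0 = subst (_≤ L + b) (sym sum≡0) (ℚ.≤-trans (load-nonNeg p≥0 σ i) (x≤x+y L 0≤b))
    via-term : ∃ (λ t → sum f ≤ L + f t) → sum f ≤ L + b
    via-term (t , sum≤) = ℚ.≤-trans sum≤
      (ℚ.+-monoʳ-≤ L (ℚ.≤-trans (restrict-≤ (onMachine σ j) (restrict-nonNeg C p≥0) t) (C≤b t)))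

-- The threshold

scaledPow4 : ℕ → ℚ → ℚ
scaledPow4 M x = pow4 (ℕ→ℚ 100 * x) * ℕ→ℚ M

isLarge : ℕ → ℚ → ℚ → Bool
isLarge M o x = ⌊ pow4 o ℚ.<? scaledPow4 M x ⌋

scaledPow4-mono-≤ : ∀ M {x y} → 0ℚ ≤ x → x ≤ y → scaledPow4 M x ≤ scaledPow4 M y
scaledPow4-mono-≤ M 0≤x x≤y = ℚ.*-monoʳ-≤-nonNeg (ℕ→ℚ M) {{ℚ.nonNegative (ℕ→ℚ-nonNeg M)}}
  (pow4-mono-≤ (*-nonNeg (ℕ→ℚ-nonNeg 100) 0≤x)
               (ℚ.*-monoˡ-≤-nonNeg (ℕ→ℚ 100) {{ℚ.nonNegative (ℕ→ℚ-nonNeg 100)}} x≤y))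

scaledPow4-zero≤ : ∀ M o → scaledPow4 M 0ℚ ≤ pow4 o
scaledPow4-zero≤ M o = subst (_≤ pow4 o) (sym (ℚ.*-zeroˡ (ℕ→ℚ M))) (pow4-nonNeg o)

small-scaledPow4≤ : ∀ M o x → scaledPow4 M (if not (isLarge M o x) then x else 0ℚ) ≤ pow4 o
small-scaledPow4≤ M o x with pow4 o ℚ.<? scaledPow4 M x
... | yes _     = scaledPow4-zero≤ M o
... | no ¬large = ℚ.≮⇒≥ ¬large

large⇒above : ∀ {M o x L} → 0ℚ ≤ x → T (isLarge M o x) → scaledPow4 M L < pow4 o → L < x
large⇒above {M} 0≤x large below = ℚ.≰⇒> λ x≤L →
  ℚ.<-asym (toWitness large) (ℚ.≤-<-trans (scaledPow4-mono-≤ M 0≤x x≤L) below)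

ℕ→ℚ-numLarge : ∀ {n} M o (p : Fin n → ℚ) →
               ℕ→ℚ (numLarge M o p) ≡ sum (restrict (isLarge M o ∘ p) (λ _ → 1ℚ))
ℕ→ℚ-numLarge {n} M o p = trans (ℕ→ℚ-length-filter _ (allFin n))
                               (sumℚ-map-tabulate id (restrict (isLarge M o ∘ p) (λ _ → 1ℚ)))

module _ {m n} {p : Fin n → ℚ} {o} (p≥0 : NonNeg p) (isOpt : IsOPT n (suc m) p o)
         {σ : Fin n → Fin (suc m)} (greedy : IsGreedy p σ) (i : Fin (suc m))
         (below : scaledPow4 (suc m) (load p σ i) < pow4 o) where

  private
    M = suc m
    L = load p σ i
    large = isLarge M o ∘ p
    k = numLarge M o p

  few-jobs-impossible : n ℕ.< M → ⊥
  few-jobs-impossible n<M = ℚ.<-irrefl refl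
    (ℚ.≤-<-trans (*-nonNeg (pow4-nonNeg (ℕ→ℚ 100 * L)) (ℕ→ℚ-nonNeg M))
                 (subst (λ x → scaledPow4 M L < pow4 x) (few-jobs⇒opt≡0 p≥0 isOpt n<M) below))

  many-large-impossible : M ℕ.≤ k → ⊥
  many-large-impossible M≤k = begin-contradiction
    ℕ→ℚ m                             <⟨ ℕ→ℚ-mono-< (ℕ.n<1+n m) ⟩
    ℕ→ℚ M                             ≤⟨ ℕ→ℚ-mono-≤ M≤k ⟩
    ℕ→ℚ k                             ≡⟨ ℕ→ℚ-numLarge M o p ⟩
    sum (restrict large (λ _ → 1ℚ))   ≤⟨ injective-avoiding⇒count≤ σ large i injective avoids-i ⟩
    ℕ→ℚ m                             ∎
    where
    above : ∀ {t} → T (large t) → L < p t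
    above {t} Lt = large⇒above {M} {o} (p≥0 t) Lt below
    injective : ∀ t u → T (large t) → T (large u) → σ t ≡ σ u → t ≡ u
    injective t u Lt Lu = greedy-aboveLoad-injective p≥0 greedy i (above Lt) (above Lu)
    avoids-i : ∀ t → T (large t) → σ t ≢ i
    avoids-i t Lt σt≡i = ℚ.<-irrefl refl (ℚ.<-≤-trans (above Lt) (job≤load p≥0 σ σt≡i))

  few-large-impossible : k ℕ.≤ M → M ℕ.^ 3 ℕ.≤ (50 ℕ.* (M ℕ.∸ k)) ℕ.^ 4 → ⊥
  few-large-impossible k≤M cube≤ = volume-threshold-contradiction {ℕ→ℚ M} {o} {ℕ→ℚ 50} {ℕ→ℚ D} {L} {b}
    (ℕ→ℚ-mono-< (ℕ.z<s {m})) (opt-nonNeg p≥0 isOpt) (ℕ→ℚ-nonNeg 50) (ℕ→ℚ-nonNeg D)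
    below b-within volume cube≤′
    where
    -- below fits the hypothesis on (50 + 50) L because ℕ→ℚ 50 + ℕ→ℚ 50 computes to ℕ→ℚ 100.
    D = M ℕ.∸ k
    small = not ∘ large
    b = max 0ℚ (tabulate (restrict small p))
    b-within : scaledPow4 M b ≤ pow4 o
    b-within = argmax-all id {P = λ x → scaledPow4 M x ≤ pow4 o} (scaledPow4-zero≤ M o)
                 (All.tabulate⁺ (λ t → small-scaledPow4≤ M o (p t)))
    0≤b : 0ℚ ≤ b
    0≤b = ⊥≤max 0ℚ (tabulate (restrict small p))
    small≤b : ∀ t → restrict small p t ≤ b
    small≤b = All.tabulate⁻ (xs≤max 0ℚ (tabulate (restrict small p)))
    small-volume : sum (restrict small p) ≤ ℕ→ℚ M * (L + b)
    small-volume = begin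
      sum (restrict small p)
        ≡⟨ sum-over-machines σ (restrict small p) ⟨
      sum (λ j → machineSum σ j (restrict small p))
        ≤⟨ sum-mono-≤ (greedy-classLoad≤ p≥0 greedy small 0≤b small≤b i) ⟩
      sum {M} (λ _ → L + b)
        ≡⟨ sum-const M (L + b) ⟩
      ℕ→ℚ M * (L + b) ∎
    K = sum (restrict large (λ _ → 1ℚ))
    M≡D+K : ℕ→ℚ M ≡ ℕ→ℚ D + K
    M≡D+K = trans (cong ℕ→ℚ (sym (ℕ.m∸n+n≡m k≤M)))
                  (trans (ℕ→ℚ-+ D k) (cong (ℕ→ℚ D +_) (ℕ→ℚ-numLarge M o p)))
    volume : ℕ→ℚ D * o ≤ ℕ→ℚ M * (L + b)
    volume = +-cancelʳ-≤ _ _ (o * K) (begin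
      ℕ→ℚ D * o + o * K                 ≡⟨ cong (ℕ→ℚ D * o +_) (ℚ.*-comm o K) ⟩
      ℕ→ℚ D * o + K * o                 ≡⟨ ℚ.*-distribʳ-+ o (ℕ→ℚ D) K ⟨
      (ℕ→ℚ D + K) * o                   ≡⟨ cong (_* o) M≡D+K ⟨
      ℕ→ℚ M * o                         ≤⟨ opt-volume-bound p≥0 isOpt large ⟩
      sum (restrict small p) + o * K    ≤⟨ ℚ.+-monoˡ-≤ (o * K) small-volume ⟩
      ℕ→ℚ M * (L + b) + o * K           ∎)
    cube≤′ : ℕ→ℚ M * ℕ→ℚ M * ℕ→ℚ M ≤ pow4 (ℕ→ℚ 50 * ℕ→ℚ D)
    cube≤′ = subst₂ _≤_ (ℕ→ℚ-cube M) (trans (ℕ→ℚ-pow4 (50 ℕ.* D)) (cong pow4 (ℕ→ℚ-* 50 D)))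
                    (ℕ→ℚ-mono-≤ cube≤)

proposition6 : (m n : ℕ) → (p : Fin n → ℚ) → (opt : ℚ) →
    NonNeg p → IsOPT n (suc m) p opt → Simple n (suc m) p opt →
    (σ : Fin n → Fin (suc m)) → IsGreedy p σ →
    ∀ i → AtLeastThreshold (suc m) opt (load p σ i)
proposition6 m n p opt p≥0 isOpt simple σ greedy i =
  decidable-stable (pow4 opt ℚ.≤? scaledPow4 (suc m) (load p σ i))
                   (λ ¬atLeast → impossible (ℚ.≰⇒> ¬atLeast) simple)
  where
  impossible : scaledPow4 (suc m) (load p σ i) < pow4 opt → Simple n (suc m) p opt → ⊥
  impossible below (inj₁ n<M)                = few-jobs-impossible p≥0 isOpt greedy i below n<M
  impossible below (inj₂ (inj₁ M≤k))         = many-large-impossible p≥0 isOpt greedy i below M≤k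
  impossible below (inj₂ (inj₂ (k≤M , cube≤))) = few-large-impossible p≥0 isOpt greedy i below k≤M cube≤
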